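{- For all positive integers $n,m$ with $m\ge n$, \[ F_{n+1}^{(m)}=(-1)^n\binom{m}{n}\sum_{l=0}^{n-1}(-1)^l\binom{n}{l}\frac{n-l}{l-m}F_{n+1}^{(l)}+\frac{m!}{(m-n)!}, \] \[ F_{n+1}^{(-m)}=(-1)^n\binom{m}{n}\sum_{l=0}^{n-1}(-1)^l\binom{n}{l}\frac{n-l}{l-m}F_{n+1}^{(-l)}+(-1)^n\frac{m!}{(m-n)!}. \] Moreover, for all positive integers $n,p$ with $n\ge p+1$, every integer $q$ with $0\le q<p$, and every $m\in\mathbb{Z}$, \[ F_{n-p+1}^{(m)}=(-1)^{n+1}n^{ -q}\sum_{l=0}^{n-1}(-1)^l\binom{n}{l}l^q F_{n-p+1}^{(m-n+l)}, \] \[ F_{n-p+1}^{(m)}=(-1)^{n+1}n^{ -p}\sum_{l=0}^{n-1}(-1)^l\binom{n}{l}l^p F_{n-p+1}^{(m-n+l)}+n^{ -p}\,n!. \]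
   Context: For $p\in\mathbb{Z}$, the generalized Fibonacci numbers $F_k^{(p)}$ are defined by $F_0^{(p)}=0$, $F_1^{(p)}=1$, $F_k^{(p)}=pF_{k-1}^{(p)}+F_{k-2}^{(p)}$ for $k\ge2$. The convention $0^0=1$ is used. -}

module Defs where

open import Data.Nat as ℕ using (ℕ; zero; suc)
open import Data.Integer as ℤ using (ℤ; +_)
open import Data.Rational as ℚ using (ℚ)
open import Data.Rational.Properties using () renaming (_≟_ to _≟ℚ_)
open import Relation.Nullary using (yes; no)
open import Relation.Nullary.Negation using (contradiction)

-- generalized Fibonacci numbers F_k^{(p)}, p ∈ ℤ
F : ℤ → ℕ → ℤ
F p zero = + 0
F p (suc zero) = + 1
F p (suc (suc k)) = p ℤ.* F p (suc k) ℤ.+ F p k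

toℚ : ℤ → ℚ
toℚ z = z ℚ./ 1

-- division on ℚ (only ever used with nonzero denominators in the statement;
-- returns 0 on a zero denominator to make it total)
_⊘_ : ℚ → ℚ → ℚ
p ⊘ q with q ≟ℚ ℚ.0ℚ
... | yes _ = ℚ.0ℚ
... | no q≢0 = ℚ._÷_ p q {{ℚ.≢-nonZero q≢0}}

sumTo : ℕ → (ℕ → ℚ) → ℚ
sumTo zero f = ℚ.0ℚ
sumTo (suc n) f = sumTo n f ℚ.+ f n

sgn : ℕ → ℤ
sgn k = ℤ.-[1+ 0 ] ℤ.^ k

module Submission where

open import Defs
open import Data.Nat as ℕ using (ℕ; _≤_; _<_; _∸_; _!)
open import Data.Nat.Combinatorics using (_C_)
open import Data.Integer as ℤ using (ℤ; +_)
open import Data.Rational as ℚ using (ℚ)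
open import Data.Product using (_×_)
open import Relation.Binary.PropositionalEquality using (_≡_)

open import Data.Nat using (zero; suc)
import Data.Nat.Properties as ℕ
import Data.Integer.Properties as ℤ
import Data.Rational.Properties as ℚ
open import Data.Product using (∃; _,_; proj₁)
open import Relation.Binary.PropositionalEquality using (refl; sym; trans; cong; cong₂; subst; module ≡-Reasoning)
open import Relation.Nullary using (¬_; yes; no)

-- For fixed k, x ↦ F_{k+1}^{(x)} is a monic integer polynomial of degree k, so its k-th forward
-- difference is the constant k!, while x ↦ F_k^{(x)} has vanishing (k+1)-th difference. Since
-- Σ_{l≤n} (-1)^l C(n,l) f(l) = (-1)^n Δⁿf(0), a function with constant n-th difference c satisfies
-- f(n) = (-1)^{n+1} Σ_{l<n} (-1)^l C(n,l) f(l) + c. Applied to x^q F_{n-p+1}^{(m-n+x)}, which has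
-- degree q + n - p, this gives the last two identities (c = 0 when q < p, c = n! when q = p).
-- For the first two, the polynomial P(x) = F_{n+1}^{(±x)} is multiplied by (x-m+1)⋯(x-n), which
-- vanishes at n, …, m-1; extrapolating the product to m in degree m leaves only the nodes l < n,
-- and their binomial weights reduce to the Lagrange weights (-1)^n C(m,n) (-1)^l C(n,l) (n-l)/(l-m).

module Binomial where

  open import Data.Nat using (_+_; _*_)
  open import Data.Nat.Properties
    using (+-assoc; +-suc; *-assoc; *-comm; *-cancelʳ-≡; ≤-trans; m≤m+n; m+n∸m≡n; m≤n⇒∃[o]m+o≡n; _!≢0; _!*_!≢0)
  open import Data.Nat.Combinatorics using (nCk≡n!/k![n-k]!; k![n∸k]!∣n!)
  open import Data.Nat.DivMod using (_/_; m/n*n≡m)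
  open import Data.Nat.Tactic.RingSolver using (solve-∀)
  open ≡-Reasoning

  nCk*[k!*[n∸k]!]≡n! : ∀ {n k} → k ≤ n → (n C k) * (k ! * (n ∸ k) !) ≡ n !
  nCk*[k!*[n∸k]!]≡n! {n} {k} k≤n = begin
    (n C k) * (k ! * (n ∸ k) !)                    ≡⟨ cong (_* (k ! * (n ∸ k) !)) (nCk≡n!/k![n-k]! k≤n) ⟩
    (n ! / (k ! * (n ∸ k) !)) * (k ! * (n ∸ k) !)  ≡⟨ m/n*n≡m (k![n∸k]!∣n! k≤n) ⟩
    n !                                            ∎
    where instance _ = k !* (n ∸ k) !≢0

  mCn*nCl*[n∸l]!*[m∸n]!≡mCl*[m∸l]! : ∀ {l n m} → l ≤ n → n ≤ m →
    (m C n) * (n C l) * (n ∸ l) ! * (m ∸ n) ! ≡ (m C l) * (m ∸ l) !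
  mCn*nCl*[n∸l]!*[m∸n]!≡mCl*[m∸l]! {l} {n} {m} l≤n n≤m =
    *-cancelʳ-≡ _ _ (l !) {{l !≢0}} (trans lhs≡m! (sym rhs≡m!))
    where
    regroup : ∀ a b c d e → a * b * c * d * e ≡ a * (b * (e * c)) * d
    regroup = solve-∀
    lhs≡m! : (m C n) * (n C l) * (n ∸ l) ! * (m ∸ n) ! * l ! ≡ m !
    lhs≡m! = begin
      (m C n) * (n C l) * (n ∸ l) ! * (m ∸ n) ! * l !      ≡⟨ regroup (m C n) (n C l) _ _ (l !) ⟩
      (m C n) * ((n C l) * (l ! * (n ∸ l) !)) * (m ∸ n) !  ≡⟨ cong (λ z → (m C n) * z * (m ∸ n) !) (nCk*[k!*[n∸k]!]≡n! l≤n) ⟩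
      (m C n) * n ! * (m ∸ n) !                            ≡⟨ *-assoc (m C n) (n !) _ ⟩
      (m C n) * (n ! * (m ∸ n) !)                          ≡⟨ nCk*[k!*[n∸k]!]≡n! n≤m ⟩
      m !                                                  ∎
    rhs≡m! : (m C l) * (m ∸ l) ! * l ! ≡ m !
    rhs≡m! = begin
      (m C l) * (m ∸ l) ! * l !    ≡⟨ *-assoc (m C l) _ (l !) ⟩
      (m C l) * ((m ∸ l) ! * l !)  ≡⟨ cong ((m C l) *_) (*-comm ((m ∸ l) !) (l !)) ⟩
      (m C l) * (l ! * (m ∸ l) !)  ≡⟨ nCk*[k!*[n∸k]!]≡n! (≤-trans l≤n n≤m) ⟩
      m !                          ∎

  m<n⇒∃[o]m+1+o≡n : ∀ {m n} → m < n → ∃ λ o → m + suc o ≡ n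
  m<n⇒∃[o]m+1+o≡n {m} m<n with m≤n⇒∃[o]m+o≡n m<n
  ... | o , 1+m+o≡n = o , trans (+-suc m o) 1+m+o≡n

  mCn*nCl*[1+a]!*k!≡mCl*[1+a+k]! : ∀ l a k → let n = l + suc a ; m = n + k in
    (m C n) * (n C l) * suc a ! * k ! ≡ (m C l) * suc (a + k) !
  mCn*nCl*[1+a]!*k!≡mCl*[1+a+k]! l a k = begin
    (m C n) * (n C l) * suc a ! * k !          ≡⟨ cong₂ (λ x y → (m C n) * (n C l) * x ! * y !)
                                                        (m+n∸m≡n l (suc a)) (m+n∸m≡n n k) ⟨
    (m C n) * (n C l) * (n ∸ l) ! * (m ∸ n) !  ≡⟨ mCn*nCl*[n∸l]!*[m∸n]!≡mCl*[m∸l]! (m≤m+n l (suc a)) (m≤m+n n k) ⟩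
    (m C l) * (m ∸ l) !                        ≡⟨ cong (λ x → (m C l) * x !)
                                                        (trans (cong (_∸ l) (+-assoc l (suc a) k)) (m+n∸m≡n l (suc a + k))) ⟩
    (m C l) * suc (a + k) !                    ∎
    where
    n = l + suc a
    m = n + k

open Binomial

module FiniteDifference where

  open import Data.Integer using (_+_; _*_; _-_; -_; _^_)
  open import Data.Nat.Combinatorics using (nCn≡1; k>n⇒nCk≡0; nCk+nC[k+1]≡[n+1]C[k+1])
  open import Data.Integer.Tactic.RingSolver using (solve-∀)
  open ≡-Reasoning

  Δ : (ℤ → ℤ) → ℤ → ℤ
  Δ f x = f (+ 1 + x) - f x

  Δ^ : ℕ → (ℤ → ℤ) → ℤ → ℤ
  Δ^ zero    f = f
  Δ^ (suc k) f = Δ (Δ^ k f)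

  Δ^-cong : ∀ k {f g : ℤ → ℤ} → (∀ x → f x ≡ g x) → ∀ x → Δ^ k f x ≡ Δ^ k g x
  Δ^-cong zero    f≗g x = f≗g x
  Δ^-cong (suc k) f≗g x = cong₂ _-_ (Δ^-cong k f≗g (+ 1 + x)) (Δ^-cong k f≗g x)

  Δ^-+ : ∀ k (f g : ℤ → ℤ) x → Δ^ k (λ y → f y + g y) x ≡ Δ^ k f x + Δ^ k g x
  Δ^-+ zero    f g x = refl
  Δ^-+ (suc k) f g x rewrite Δ^-+ k f g (+ 1 + x) | Δ^-+ k f g x =
    regroup (Δ^ k f (+ 1 + x)) (Δ^ k g (+ 1 + x)) (Δ^ k f x) (Δ^ k g x)
    where regroup : ∀ a b c d → a + b - (c + d) ≡ (a - c) + (b - d)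
          regroup = solve-∀

  Δ^-*ˡ : ∀ k a (f : ℤ → ℤ) x → Δ^ k (λ y → a * f y) x ≡ a * Δ^ k f x
  Δ^-*ˡ zero    a f x = refl
  Δ^-*ˡ (suc k) a f x rewrite Δ^-*ˡ k a f (+ 1 + x) | Δ^-*ˡ k a f x =
    factor a (Δ^ k f (+ 1 + x)) (Δ^ k f x)
    where factor : ∀ a b c → a * b - a * c ≡ a * (b - c)
          factor = solve-∀

  Δ^-shift : ∀ k b (f : ℤ → ℤ) x → Δ^ k (λ y → f (b + y)) x ≡ Δ^ k f (b + x)
  Δ^-shift zero    b f x = refl
  Δ^-shift (suc k) b f x rewrite Δ^-shift k b f (+ 1 + x) | Δ^-shift k b f x =
    cong (λ z → Δ^ k f z - Δ^ k f (b + x)) (swap b x)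
    where swap : ∀ b x → b + (+ 1 + x) ≡ + 1 + (b + x)
          swap = solve-∀

  Δ^-x* : ∀ k (f : ℤ → ℤ) x →
    Δ^ (suc k) (λ y → y * f y) x ≡ x * Δ^ (suc k) f x + + suc k * Δ^ k f (+ 1 + x)
  Δ^-x* zero    f x = step x (f (+ 1 + x)) (f x)
    where step : ∀ x a b → (+ 1 + x) * a - x * b ≡ x * (a - b) + + 1 * a
          step = solve-∀
  Δ^-x* (suc k) f x rewrite Δ^-x* k f (+ 1 + x) | Δ^-x* k f x =
    step x (+ suc k) (Δ^ k f (+ 1 + (+ 1 + x))) (Δ^ k f (+ 1 + x)) (Δ^ k f x)
    where step : ∀ x κ a b c → (+ 1 + x) * (a - b) + κ * a - (x * (b - c) + κ * b)
                             ≡ x * ((a - b) - (b - c)) + (+ 1 + κ) * (a - b)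
          step = solve-∀

  record ConstantΔ^ (d : ℕ) (c : ℤ) (f : ℤ → ℤ) : Set where
    constructor constantΔ^
    field Δ^≡ : ∀ x → Δ^ d f x ≡ c
  open ConstantΔ^

  ConstantΔ^-cong : ∀ {d c} {f g : ℤ → ℤ} → (∀ x → f x ≡ g x) → ConstantΔ^ d c f → ConstantΔ^ d c g
  ConstantΔ^-cong {d} f≗g h = constantΔ^ λ x → trans (sym (Δ^-cong d f≗g x)) (Δ^≡ h x)

  ConstantΔ^-suc : ∀ {d c f} → ConstantΔ^ d c f → ConstantΔ^ (suc d) (+ 0) f
  ConstantΔ^-suc {c = c} h = constantΔ^ λ x →
    trans (cong₂ _-_ (Δ^≡ h (+ 1 + x)) (Δ^≡ h x)) (ℤ.+-inverseʳ c)

  ConstantΔ^-< : ∀ {d e c f} → d ℕ.< e → ConstantΔ^ d c f → ConstantΔ^ e (+ 0) f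
  ConstantΔ^-< {d} {suc e} d<1+e h with d ℕ.≟ e
  ... | yes refl = ConstantΔ^-suc h
  ... | no  d≢e  = ConstantΔ^-suc (ConstantΔ^-< (ℕ.≤∧≢⇒< (ℕ.≤-pred d<1+e) d≢e) h)

  ConstantΔ^-+ : ∀ {d a b f g} → ConstantΔ^ d a f → ConstantΔ^ d b g → ConstantΔ^ d (a + b) (λ y → f y + g y)
  ConstantΔ^-+ {d} {f = f} {g} hf hg =
    constantΔ^ λ x → trans (Δ^-+ d f g x) (cong₂ _+_ (Δ^≡ hf x) (Δ^≡ hg x))

  ConstantΔ^-*ˡ : ∀ {d c f} a → ConstantΔ^ d c f → ConstantΔ^ d (a * c) (λ y → a * f y)
  ConstantΔ^-*ˡ {d} {f = f} a h = constantΔ^ λ x → trans (Δ^-*ˡ d a f x) (cong (a *_) (Δ^≡ h x))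

  ConstantΔ^-shift : ∀ {d c f} b → ConstantΔ^ d c f → ConstantΔ^ d c (λ y → f (b + y))
  ConstantΔ^-shift {d} {f = f} b h = constantΔ^ λ x → trans (Δ^-shift d b f x) (Δ^≡ h (b + x))

  ConstantΔ^-x* : ∀ {d c f} → ConstantΔ^ d c f → ConstantΔ^ (suc d) (+ suc d * c) (λ y → y * f y)
  ConstantΔ^-x* {d} {c} {f} h = constantΔ^ λ x → begin
    Δ^ (suc d) (λ y → y * f y) x                     ≡⟨ Δ^-x* d f x ⟩
    x * Δ^ (suc d) f x + + suc d * Δ^ d f (+ 1 + x)   ≡⟨ cong₂ (λ u v → x * u + + suc d * v)
                                                          (Δ^≡ (ConstantΔ^-suc h) x) (Δ^≡ h (+ 1 + x)) ⟩
    x * + 0 + + suc d * c                            ≡⟨ cong (_+ + suc d * c) (ℤ.*-zeroʳ x) ⟩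
    + 0 + + suc d * c                                ≡⟨ ℤ.+-identityˡ _ ⟩
    + suc d * c                                      ∎

  ConstantΔ^-x^* : ∀ q {d f} → ConstantΔ^ d (+ (d !)) f →
    ConstantΔ^ (q ℕ.+ d) (+ ((q ℕ.+ d) !)) (λ x → x ^ q * f x)
  ConstantΔ^-x^* zero    {f = f} h = ConstantΔ^-cong (λ x → sym (ℤ.*-identityˡ (f x))) h
  ConstantΔ^-x^* (suc q) {d} {f} h =
    subst (λ c → ConstantΔ^ (suc (q ℕ.+ d)) c (λ x → x ^ suc q * f x)) (sym (ℤ.pos-* (suc (q ℕ.+ d)) _))
      (ConstantΔ^-cong (λ x → sym (ℤ.*-assoc x (x ^ q) (f x))) (ConstantΔ^-x* (ConstantΔ^-x^* q h)))

  ConstantΔ^-F : ∀ k → ConstantΔ^ k (+ (k !)) (λ x → F x (suc k)) × ConstantΔ^ (suc k) (+ 0) (λ x → F x k)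
  ConstantΔ^-F zero    = constantΔ^ (λ _ → refl) , constantΔ^ (λ _ → refl)
  ConstantΔ^-F (suc k) with ConstantΔ^-F k
  ... | hsuc , h = subst (λ c → ConstantΔ^ (suc k) c (λ x → F x (suc (suc k)))) k!-step
                     (ConstantΔ^-+ (ConstantΔ^-x* hsuc) h)
                 , ConstantΔ^-suc (ConstantΔ^-suc hsuc)
    where k!-step : + suc k * + (k !) + + 0 ≡ + (suc k !)
          k!-step = trans (ℤ.+-identityʳ _) (sym (ℤ.pos-* (suc k) (k !)))

  F-neg : ∀ x n → F (- x) (suc n) ≡ sgn n * F x (suc n)
  F-neg x zero          = refl
  F-neg x (suc zero)    = flip x
    where flip : ∀ x → - x * + 1 + + 0 ≡ - + 1 * (x * + 1 + + 0)
          flip = solve-∀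
  F-neg x (suc (suc n)) rewrite F-neg x (suc n) | F-neg x n =
    flip (sgn n) x (F x (suc (suc n))) (F x (suc n))
    where flip : ∀ σ x a b → - x * (- + 1 * σ * a) + σ * b ≡ - + 1 * (- + 1 * σ) * (x * a + b)
          flip = solve-∀

  ConstantΔ^-x^q*F : ∀ q k b {d} → q ℕ.+ k ≡ d →
    ConstantΔ^ d (+ (d !)) (λ x → x ^ q * F (b + x) (k ℕ.+ 1))
  ConstantΔ^-x^q*F q k b refl = ConstantΔ^-x^* q (ConstantΔ^-shift b
    (ConstantΔ^-cong (λ x → cong (F x) (ℕ.+-comm 1 k)) (proj₁ (ConstantΔ^-F k))))

  sgn*sgn≡1 : ∀ n → sgn n * sgn n ≡ + 1
  sgn*sgn≡1 zero    = refl
  sgn*sgn≡1 (suc n) = trans (square-neg (sgn n)) (sgn*sgn≡1 n)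
    where square-neg : ∀ s → (- + 1 * s) * (- + 1 * s) ≡ s * s
          square-neg = solve-∀

  sumToℤ : ℕ → (ℕ → ℤ) → ℤ
  sumToℤ zero    g = + 0
  sumToℤ (suc n) g = sumToℤ n g + g n

  sumToℤ-cong< : ∀ n {g h : ℕ → ℤ} → (∀ l → l ℕ.< n → g l ≡ h l) → sumToℤ n g ≡ sumToℤ n h
  sumToℤ-cong< zero    g≗h = refl
  sumToℤ-cong< (suc n) g≗h =
    cong₂ _+_ (sumToℤ-cong< n (λ l l<n → g≗h l (ℕ.m<n⇒m<1+n l<n))) (g≗h n ℕ.≤-refl)

  sumToℤ-zero : ∀ n (g : ℕ → ℤ) → (∀ l → l ℕ.< n → g l ≡ + 0) → sumToℤ n g ≡ + 0
  sumToℤ-zero zero    g g≗0 = refl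
  sumToℤ-zero (suc n) g g≗0 = cong₂ _+_ (sumToℤ-zero n g (λ l l<n → g≗0 l (ℕ.m<n⇒m<1+n l<n))) (g≗0 n ℕ.≤-refl)

  sumToℤ-minus : ∀ n (g h : ℕ → ℤ) → sumToℤ n (λ l → g l - h l) ≡ sumToℤ n g - sumToℤ n h
  sumToℤ-minus zero    g h = refl
  sumToℤ-minus (suc n) g h rewrite sumToℤ-minus n g h = regroup (sumToℤ n g) (sumToℤ n h) (g n) (h n)
    where regroup : ∀ a b c d → a - b + (c - d) ≡ a + c - (b + d)
          regroup = solve-∀

  sumToℤ-*ˡ : ∀ n a (g : ℕ → ℤ) → sumToℤ n (λ l → a * g l) ≡ a * sumToℤ n g
  sumToℤ-*ˡ zero    a g = sym (ℤ.*-zeroʳ a)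
  sumToℤ-*ˡ (suc n) a g rewrite sumToℤ-*ˡ n a g = sym (ℤ.*-distribˡ-+ a (sumToℤ n g) (g n))

  sumToℤ-suc : ∀ n (g : ℕ → ℤ) → sumToℤ (suc n) g ≡ g 0 + sumToℤ n (λ l → g (suc l))
  sumToℤ-suc zero    g = ℤ.+-comm (+ 0) (g 0)
  sumToℤ-suc (suc n) g rewrite sumToℤ-suc n g = ℤ.+-assoc (g 0) _ _

  sumToℤ-+ : ∀ a b (g : ℕ → ℤ) → sumToℤ (a ℕ.+ b) g ≡ sumToℤ a g + sumToℤ b (λ j → g (a ℕ.+ j))
  sumToℤ-+ a zero    g rewrite ℕ.+-identityʳ a = sym (ℤ.+-identityʳ (sumToℤ a g))
  sumToℤ-+ a (suc b) g rewrite ℕ.+-suc a b | sumToℤ-+ a b g = ℤ.+-assoc (sumToℤ a g) _ _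

  alternatingSum : ℕ → (ℤ → ℤ) → ℤ
  alternatingSum n f = sumToℤ (suc n) (λ l → sgn l * + (n C l) * f (+ l))

  alternatingSum-suc : ∀ n f → alternatingSum (suc n) f ≡ alternatingSum n f - alternatingSum n (λ x → f (+ 1 + x))
  alternatingSum-suc n f = begin
    sumToℤ (suc (suc n)) t′
      ≡⟨ sumToℤ-suc (suc n) t′ ⟩
    t 0 + sumToℤ (suc n) (λ l → t′ (suc l))
      ≡⟨ cong (λ z → t 0 + z) (sumToℤ-cong< (suc n) (λ l _ → pascal l)) ⟩
    t 0 + sumToℤ (suc n) (λ l → t (suc l) - u l)
      ≡⟨ cong (λ z → t 0 + z) (sumToℤ-minus (suc n) (λ l → t (suc l)) u) ⟩
    t 0 + (sumToℤ (suc n) (λ l → t (suc l)) - sumToℤ (suc n) u)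
      ≡⟨ ℤ.+-assoc (t 0) _ _ ⟨
    t 0 + sumToℤ (suc n) (λ l → t (suc l)) - sumToℤ (suc n) u
      ≡⟨ cong (_- sumToℤ (suc n) u) (sumToℤ-suc (suc n) t) ⟨
    sumToℤ (suc n) t + t (suc n) - sumToℤ (suc n) u
      ≡⟨ cong (λ z → sumToℤ (suc n) t + z - sumToℤ (suc n) u) t[1+n]≡0 ⟩
    sumToℤ (suc n) t + + 0 - sumToℤ (suc n) u
      ≡⟨ cong (_- sumToℤ (suc n) u) (ℤ.+-identityʳ (sumToℤ (suc n) t)) ⟩
    sumToℤ (suc n) t - sumToℤ (suc n) u
      ∎
    where
    t′ t u : ℕ → ℤ
    t′ l = sgn l * + (suc n C l) * f (+ l)
    t  l = sgn l * + (n C l) * f (+ l)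
    u  l = sgn l * + (n C l) * f (+ 1 + + l)
    pascal : ∀ l → t′ (suc l) ≡ t (suc l) - u l
    pascal l rewrite sym (nCk+nC[k+1]≡[n+1]C[k+1] n l) | ℤ.pos-+ (n C l) (n C suc l) =
      expand (sgn l) (+ (n C l)) (+ (n C suc l)) (f (+ suc l))
      where expand : ∀ s a b y → (- + 1 * s) * (a + b) * y ≡ (- + 1 * s) * b * y - s * a * y
            expand = solve-∀
    t[1+n]≡0 : t (suc n) ≡ + 0
    t[1+n]≡0 rewrite k>n⇒nCk≡0 (ℕ.n<1+n n) =
      trans (cong (_* f (+ suc n)) (ℤ.*-zeroʳ (sgn (suc n)))) (ℤ.*-zeroˡ (f (+ suc n)))

  alternatingSum≡sgn*Δ^ : ∀ n f → alternatingSum n f ≡ sgn n * Δ^ n f (+ 0)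
  alternatingSum≡sgn*Δ^ zero    f = ℤ.+-identityˡ _
  alternatingSum≡sgn*Δ^ (suc n) f
    rewrite alternatingSum-suc n f | alternatingSum≡sgn*Δ^ n f | alternatingSum≡sgn*Δ^ n (λ x → f (+ 1 + x))
          | Δ^-shift n (+ 1) f (+ 0) = factor (sgn n) (Δ^ n f (+ 0)) (Δ^ n f (+ 1 + + 0))
    where factor : ∀ s a b → s * a - s * b ≡ (- + 1 * s) * (b - a)
          factor = solve-∀

  ConstantΔ^-extrapolate : ∀ {n c f} → ConstantΔ^ n c f →
    f (+ n) ≡ sgn (suc n) * sumToℤ n (λ l → sgn l * + (n C l) * f (+ l)) + c
  ConstantΔ^-extrapolate {n} {c} {f} h = begin
    f (+ n)                         ≡⟨ sym (ℤ.*-identityˡ (f (+ n))) ⟩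
    + 1 * f (+ n)                   ≡⟨ cong (_* f (+ n)) (sym (sgn*sgn≡1 n)) ⟩
    σ * σ * f (+ n)                 ≡⟨ expand σ s (f (+ n)) ⟩
    σ * (s + σ * f (+ n)) - σ * s   ≡⟨ cong (λ z → σ * z - σ * s) alternating ⟩
    σ * (σ * c) - σ * s             ≡⟨ cong (_- σ * s) (ℤ.*-assoc σ σ c) ⟨
    σ * σ * c - σ * s               ≡⟨ cong (λ z → z * c - σ * s) (sgn*sgn≡1 n) ⟩
    + 1 * c - σ * s                 ≡⟨ collect σ s c ⟩
    - + 1 * σ * s + c               ∎
    where
    σ s : ℤ
    σ = sgn n
    s = sumToℤ n (λ l → sgn l * + (n C l) * f (+ l))
    expand : ∀ σ s a → σ * σ * a ≡ σ * (s + σ * a) - σ * s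
    expand = solve-∀
    collect : ∀ σ s c → + 1 * c - σ * s ≡ - + 1 * σ * s + c
    collect = solve-∀
    alternating : s + σ * f (+ n) ≡ σ * c
    alternating = begin
      s + σ * f (+ n)                        ≡⟨ cong (λ z → s + z * f (+ n)) (ℤ.*-identityʳ σ) ⟨
      s + σ * + 1 * f (+ n)                  ≡⟨ cong (λ z → s + σ * + z * f (+ n)) (nCn≡1 n) ⟨
      s + σ * + (n C n) * f (+ n)            ≡⟨ alternatingSum≡sgn*Δ^ n f ⟩
      σ * Δ^ n f (+ 0)                       ≡⟨ cong (σ *_) (Δ^≡ h (+ 0)) ⟩
      σ * c                                  ∎

open FiniteDifference

module RisingFactorial where

  open import Data.Integer using (_+_; _*_; _-_; -_)
  open import Data.Integer.Tactic.RingSolver using (solve-∀)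
  open ≡-Reasoning

  rising : ℤ → ℕ → ℤ
  rising b zero    = + 1
  rising b (suc k) = (b + + suc k) * rising b k

  rising-0 : ∀ k → rising (+ 0) k ≡ + (k !)
  rising-0 zero    = refl
  rising-0 (suc k) rewrite rising-0 k = sym (ℤ.pos-* (suc k) (k !))

  rising-vanishes : ∀ {j k} → j ℕ.< k → rising (- + suc j) k ≡ + 0
  rising-vanishes {j} {suc k} j<1+k with j ℕ.≟ k
  ... | yes refl = trans (cong (_* rising (- + suc j) j) (ℤ.+-inverseˡ (+ suc j)))
                         (ℤ.*-zeroˡ (rising (- + suc j) j))
  ... | no  j≢k  = trans (cong ((- + suc j + + suc k) *_) (rising-vanishes (ℕ.≤∧≢⇒< (ℕ.≤-pred j<1+k) j≢k)))
                         (ℤ.*-zeroʳ (- + suc j + + suc k))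

  rising-neg : ∀ a k → rising (- + suc (a ℕ.+ k)) k * + (a !) ≡ sgn k * + ((a ℕ.+ k) !)
  rising-neg a zero    rewrite ℕ.+-identityʳ a = refl
  rising-neg a (suc k) rewrite ℕ.+-suc a k = begin
    (- + suc (suc (a ℕ.+ k)) + + suc k) * r * + (a !) ≡⟨ cong (λ z → z * r * + (a !)) top-factor ⟩
    - + suc a * r * + (a !)                            ≡⟨ regroup (+ suc a) r (+ (a !)) ⟩
    - (r * (+ suc a * + (a !)))                        ≡⟨ cong (λ z → - (r * z)) (ℤ.pos-* (suc a) (a !)) ⟨
    - (r * + (suc a !))                                ≡⟨ cong -_ (rising-neg (suc a) k) ⟩
    - (sgn k * + (suc (a ℕ.+ k) !))                    ≡⟨ ℤ.-1*i≡-i _ ⟨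
    - + 1 * (sgn k * + (suc (a ℕ.+ k) !))              ≡⟨ ℤ.*-assoc (- + 1) (sgn k) _ ⟨
    sgn (suc k) * + (suc (a ℕ.+ k) !)                  ∎
    where
    r = rising (- + suc (suc (a ℕ.+ k))) k
    top-factor : - + suc (suc (a ℕ.+ k)) + + suc k ≡ - + suc a
    top-factor rewrite ℤ.pos-+ (suc (suc a)) k = cancel (+ a) (+ k)
      where cancel : ∀ a k → - (+ 1 + (+ 1 + a) + k) + (+ 1 + k) ≡ - (+ 1 + a)
            cancel = solve-∀
    regroup : ∀ α r f → - α * r * f ≡ - (r * (α * f))
    regroup = solve-∀

  ConstantΔ^-rising* : ∀ b k {n s P} → ConstantΔ^ n (s * + (n !)) P →
    ConstantΔ^ (k ℕ.+ n) (s * + ((k ℕ.+ n) !)) (λ x → rising (x - b) k * P x)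
  ConstantΔ^-rising* b zero    {P = P} h = ConstantΔ^-cong (λ x → sym (ℤ.*-identityˡ (P x))) h
  ConstantΔ^-rising* b (suc k) {n} {s} {P} h =
    ConstantΔ^-cong expand (subst (λ c → ConstantΔ^ (suc d) c (λ x → x * Q x + β * Q x)) leading
      (ConstantΔ^-+ (ConstantΔ^-x* hQ) (ConstantΔ^-*ˡ β (ConstantΔ^-suc hQ))))
    where
    d = k ℕ.+ n
    β = - b + + suc k
    Q : ℤ → ℤ
    Q x = rising (x - b) k * P x
    hQ : ConstantΔ^ d (s * + (d !)) Q
    hQ = ConstantΔ^-rising* b k {n} {s} {P} h
    expand : ∀ x → x * Q x + β * Q x ≡ rising (x - b) (suc k) * P x
    expand x = distrib x b (+ suc k) (rising (x - b) k) (P x)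
      where distrib : ∀ x b j r p → x * (r * p) + (- b + j) * (r * p) ≡ (x - b + j) * r * p
            distrib = solve-∀
    leading : + suc d * (s * + (d !)) + β * + 0 ≡ s * + (suc d !)
    leading = trans (collect (+ suc d) s (+ (d !)) β) (cong (s *_) (sym (ℤ.pos-* (suc d) (d !))))
      where collect : ∀ a s f β → a * (s * f) + β * + 0 ≡ s * (a * f)
            collect = solve-∀

  rising-vanishes-between : ∀ n {j k} → j ℕ.< k → rising (+ (n ℕ.+ j) - + (n ℕ.+ k)) k ≡ + 0
  rising-vanishes-between n {j} j<k with ℕ.m≤n⇒∃[o]m+o≡n j<k
  ... | d , refl = trans (cong (λ b → rising b (suc j ℕ.+ d)) gap) (rising-vanishes (ℕ.m<n+m d ℕ.z<s))
    where
    gap : + (n ℕ.+ j) - + (n ℕ.+ suc (j ℕ.+ d)) ≡ - + suc d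
    gap rewrite ℤ.pos-+ n j | ℤ.pos-+ n (suc (j ℕ.+ d)) | ℤ.pos-+ (suc j) d = cancel (+ n) (+ j) (+ d)
      where cancel : ∀ n j d → n + j - (n + (+ 1 + j + d)) ≡ - (+ 1 + d)
            cancel = solve-∀

  ConstantΔ^-interpolate : ∀ n k {s P} → ConstantΔ^ n (s * + (n !)) P →
    + (k !) * P (+ (n ℕ.+ k))
      ≡ sgn (suc (n ℕ.+ k)) * sumToℤ n (λ l → sgn l * + ((n ℕ.+ k) C l) * (rising (+ l - + (n ℕ.+ k)) k * P (+ l)))
        + s * + ((n ℕ.+ k) !)
  ConstantΔ^-interpolate n k {s} {P} h = begin
    + (k !) * P (+ m)                                       ≡⟨ cong (λ r → r * P (+ m)) G[m] ⟨
    G (+ m)                                                 ≡⟨ ConstantΔ^-extrapolate hG ⟩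
    sgn (suc m) * sumToℤ m t + s * + (m !)                  ≡⟨ cong (λ z → sgn (suc m) * z + s * + (m !)) drop-vanishing ⟩
    sgn (suc m) * sumToℤ n t + s * + (m !)                  ∎
    where
    m = n ℕ.+ k
    G : ℤ → ℤ
    G x = rising (x - + m) k * P x
    t : ℕ → ℤ
    t l = sgn l * + (m C l) * G (+ l)
    hG : ConstantΔ^ m (s * + (m !)) G
    hG = subst (λ d → ConstantΔ^ d (s * + (d !)) G) (ℕ.+-comm k n) (ConstantΔ^-rising* (+ m) k {n} {s} {P} h)
    G[m] : rising (+ m - + m) k ≡ + (k !)
    G[m] = trans (cong (λ b → rising b k) (ℤ.+-inverseʳ (+ m))) (rising-0 k)
    t≡0 : ∀ j → j ℕ.< k → t (n ℕ.+ j) ≡ + 0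
    t≡0 j j<k rewrite rising-vanishes-between n j<k | ℤ.*-zeroˡ (P (+ (n ℕ.+ j))) =
      ℤ.*-zeroʳ (sgn (n ℕ.+ j) * + (m C (n ℕ.+ j)))
    drop-vanishing : sumToℤ m t ≡ sumToℤ n t
    drop-vanishing = begin
      sumToℤ m t                                     ≡⟨ sumToℤ-+ n k t ⟩
      sumToℤ n t + sumToℤ k (λ j → t (n ℕ.+ j))      ≡⟨ cong (λ z → sumToℤ n t + z) (sumToℤ-zero k _ t≡0) ⟩
      sumToℤ n t + + 0                               ≡⟨ ℤ.+-identityʳ _ ⟩
      sumToℤ n t                                     ∎

  -- Relates the weight of node l in ConstantΔ^-interpolate to the paper's weight
  -- (-1)^n C(m,n) C(n,l) (n - l) / (l - m).
  node-weight′ : ∀ l a k → let n = l ℕ.+ suc a ; m = n ℕ.+ k in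
    sgn n * + (m C n) * + (n C l) * (+ n - + l) * + (k !)
      ≡ sgn (suc m) * + (m C l) * rising (+ l - + m) k * (+ l - + m)
  node-weight′ l a k = ℤ.*-cancelʳ-≡ _ _ (+ (a !)) {{ℕ._!≢0 a}} (begin
    σn * C₁ * C₂ * (+ n - + l) * K * A      ≡⟨ cong (λ z → σn * C₁ * C₂ * z * K * A) n-l ⟩
    σn * C₁ * C₂ * α * K * A                ≡⟨ regroupˡ σn C₁ C₂ α K A ⟩
    σn * (C₁ * C₂ * (α * A) * K)            ≡⟨ cong (σn *_) binomial ⟩
    σn * (C₃ * (β * B))                     ≡⟨ cong (_* (C₃ * (β * B))) (ℤ.*-identityʳ σn) ⟨
    σn * + 1 * (C₃ * (β * B))               ≡⟨ cong (λ z → σn * z * (C₃ * (β * B))) (sgn*sgn≡1 k) ⟨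
    σn * (σk * σk) * (C₃ * (β * B))         ≡⟨ regroupʳ σn σk C₃ β B ⟩
    σn * σk * C₃ * β * (σk * B)             ≡⟨ cong (σn * σk * C₃ * β *_) (rising-neg a k) ⟨
    σn * σk * C₃ * β * (rising (- β) k * A)  ≡⟨ cong (λ b → σn * σk * C₃ * β * (rising b k * A)) l-m ⟨
    σn * σk * C₃ * β * (R * A)              ≡⟨ flip-sign σn σk C₃ β R A ⟩
    - + 1 * (σn * σk) * C₃ * R * (- β) * A  ≡⟨ cong₂ (λ σ z → - + 1 * σ * C₃ * R * z * A) (sym σm) (sym l-m) ⟩
    sgn (suc m) * C₃ * R * (+ l - + m) * A  ∎)
    where
    n = l ℕ.+ suc a
    m = n ℕ.+ k
    σn = sgn n
    σk = sgn k
    C₁ = + (m C n)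
    C₂ = + (n C l)
    C₃ = + (m C l)
    α = + suc a
    β = + suc (a ℕ.+ k)
    A = + (a !)
    B = + ((a ℕ.+ k) !)
    K = + (k !)
    R = rising (+ l - + m) k
    n-l : + n - + l ≡ α
    n-l rewrite ℤ.pos-+ l (suc a) = cancel (+ l) α
      where cancel : ∀ x y → x + y - x ≡ y
            cancel = solve-∀
    l-m : + l - + m ≡ - β
    l-m rewrite ℕ.+-assoc l (suc a) k | ℤ.pos-+ l (suc (a ℕ.+ k)) = cancel (+ l) β
      where cancel : ∀ x y → x - (x + y) ≡ - y
            cancel = solve-∀
    σm : sgn m ≡ σn * σk
    σm = ℤ.^-distribˡ-+-* (- + 1) n k
    binomial : C₁ * C₂ * (α * A) * K ≡ C₃ * (β * B)
    binomial = begin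
      C₁ * C₂ * (α * A) * K                        ≡⟨ cong (λ z → C₁ * C₂ * z * K) (ℤ.pos-* (suc a) (a !)) ⟨
      C₁ * C₂ * + (suc a !) * K                    ≡⟨ pos-*₄ (m C n) (n C l) (suc a !) (k !) ⟨
      + ((m C n) ℕ.* (n C l) ℕ.* suc a ! ℕ.* k !)  ≡⟨ cong +_ (mCn*nCl*[1+a]!*k!≡mCl*[1+a+k]! l a k) ⟩
      + ((m C l) ℕ.* suc (a ℕ.+ k) !)              ≡⟨ ℤ.pos-* (m C l) _ ⟩
      C₃ * + (suc (a ℕ.+ k) !)                     ≡⟨ cong (C₃ *_) (ℤ.pos-* (suc (a ℕ.+ k)) ((a ℕ.+ k) !)) ⟩
      C₃ * (β * B)                                 ∎
      where
      pos-*₄ : ∀ w x y z → + (w ℕ.* x ℕ.* y ℕ.* z) ≡ + w * + x * + y * + z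
      pos-*₄ w x y z = trans (ℤ.pos-* (w ℕ.* x ℕ.* y) z)
        (cong (_* + z) (trans (ℤ.pos-* (w ℕ.* x) y) (cong (_* + y) (ℤ.pos-* w x))))
    regroupˡ : ∀ σ c₁ c₂ α κ a → σ * c₁ * c₂ * α * κ * a ≡ σ * (c₁ * c₂ * (α * a) * κ)
    regroupˡ = solve-∀
    regroupʳ : ∀ σ τ c β b → σ * (τ * τ) * (c * (β * b)) ≡ σ * τ * c * β * (τ * b)
    regroupʳ = solve-∀
    flip-sign : ∀ σ τ c β r a → σ * τ * c * β * (r * a) ≡ - + 1 * (σ * τ) * c * r * (- β) * a
    flip-sign = solve-∀

  node-weight : ∀ {l n} k → l ℕ.< n → let m = n ℕ.+ k in
    sgn n * + (m C n) * + (n C l) * (+ n - + l) * + (k !)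
      ≡ sgn (suc m) * + (m C l) * rising (+ l - + m) k * (+ l - + m)
  node-weight {l} k l<n with m<n⇒∃[o]m+1+o≡n l<n
  ... | a , refl = node-weight′ l a k

open RisingFactorial

module RationalEmbedding where

  open import Data.Rational using (mkℚ; 0ℚ; 1ℚ; _+_; _*_; 1/_; ↥_; ≢-nonZero)
  import Data.Nat.Coprimality as Coprime
  open import Data.Rational.Solver using (module +-*-Solver)
  open +-*-Solver using (solve; _:+_; _:*_; _:=_)
  open import Relation.Nullary.Negation using (contradiction)
  open ≡-Reasoning

  toℚ≡mkℚ : ∀ z → toℚ z ≡ mkℚ z 0 (Coprime.sym (Coprime.1-coprimeTo ℤ.∣ z ∣))
  toℚ≡mkℚ z = ℚ.fromℚᵘ-toℚᵘ (mkℚ z 0 (Coprime.sym (Coprime.1-coprimeTo ℤ.∣ z ∣)))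

  toℚ-+ : ∀ a b → toℚ (a ℤ.+ b) ≡ toℚ a + toℚ b
  toℚ-+ a b rewrite toℚ≡mkℚ a | toℚ≡mkℚ b =
    cong toℚ (cong₂ ℤ._+_ (sym (ℤ.*-identityʳ a)) (sym (ℤ.*-identityʳ b)))

  toℚ-* : ∀ a b → toℚ (a ℤ.* b) ≡ toℚ a * toℚ b
  toℚ-* a b rewrite toℚ≡mkℚ a | toℚ≡mkℚ b = refl

  toℚ-injective : ∀ {a b} → toℚ a ≡ toℚ b → a ≡ b
  toℚ-injective {a} {b} eq rewrite toℚ≡mkℚ a | toℚ≡mkℚ b = cong ↥_ eq

  toℚ-≢0 : ∀ {a} → ¬ (a ≡ + 0) → ¬ (toℚ a ≡ 0ℚ)
  toℚ-≢0 a≢0 eq = a≢0 (toℚ-injective eq)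

  p⊘q*q≡p : ∀ p q → ¬ (q ≡ 0ℚ) → (p ⊘ q) * q ≡ p
  p⊘q*q≡p p q q≢0 with q ℚ.≟ 0ℚ
  ... | yes q≡0 = contradiction q≡0 q≢0
  ... | no  q≢0 = begin
    p * 1/ q * q   ≡⟨ ℚ.*-assoc p _ q ⟩
    p * (1/ q * q) ≡⟨ cong (p *_) (ℚ.*-inverseˡ q) ⟩
    p * 1ℚ         ≡⟨ ℚ.*-identityʳ p ⟩
    p              ∎
    where instance _ = ≢-nonZero q≢0

  *-cancelʳ-≡ : ∀ p r q → ¬ (q ≡ 0ℚ) → p * q ≡ r * q → p ≡ r
  *-cancelʳ-≡ p r q q≢0 eq = begin
    p                      ≡⟨ undo p ⟩
    p * q * (1ℚ ⊘ q)       ≡⟨ cong (_* (1ℚ ⊘ q)) eq ⟩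
    r * q * (1ℚ ⊘ q)       ≡⟨ undo r ⟨
    r                      ∎
    where
    reassoc : ∀ a q w → a * (w * q) ≡ a * q * w
    reassoc = solve 3 (λ a q w → a :* (w :* q) := a :* q :* w) refl
    undo : ∀ a → a ≡ a * q * (1ℚ ⊘ q)
    undo a = begin
      a                    ≡⟨ ℚ.*-identityʳ a ⟨
      a * 1ℚ               ≡⟨ cong (a *_) (p⊘q*q≡p 1ℚ q q≢0) ⟨
      a * ((1ℚ ⊘ q) * q)   ≡⟨ reassoc a q (1ℚ ⊘ q) ⟩
      a * q * (1ℚ ⊘ q)     ∎

  toℚ-sumToℤ : ∀ n (g : ℕ → ℤ) → toℚ (sumToℤ n g) ≡ sumTo n (λ l → toℚ (g l))
  toℚ-sumToℤ zero    g = refl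
  toℚ-sumToℤ (suc n) g rewrite sym (toℚ-sumToℤ n g) = toℚ-+ (sumToℤ n g) (g n)

  sumTo-cong< : ∀ n {f g : ℕ → ℚ} → (∀ l → l ℕ.< n → f l ≡ g l) → sumTo n f ≡ sumTo n g
  sumTo-cong< zero    f≗g = refl
  sumTo-cong< (suc n) f≗g = cong₂ _+_ (sumTo-cong< n (λ l l<n → f≗g l (ℕ.m<n⇒m<1+n l<n))) (f≗g n ℕ.≤-refl)

  sumTo-* : ∀ n a d (f : ℕ → ℚ) → a * sumTo n f * d ≡ sumTo n (λ l → a * f l * d)
  sumTo-* zero    a d f = trans (cong (_* d) (ℚ.*-zeroʳ a)) (ℚ.*-zeroˡ d)
  sumTo-* (suc n) a d f rewrite sym (sumTo-* n a d f) = distrib a (sumTo n f) (f n) d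
    where distrib : ∀ a s x d → a * (s + x) * d ≡ a * s * d + a * x * d
          distrib = solve 4 (λ a s x d → a :* (s :+ x) :* d := a :* s :* d :+ a :* x :* d) refl

  toℚ-divide : ∀ (N X σ s c : ℤ) → ¬ (N ≡ + 0) → N ℤ.* X ≡ σ ℤ.* s ℤ.+ c →
    toℚ X ≡ toℚ σ * (1ℚ ⊘ toℚ N) * toℚ s + (1ℚ ⊘ toℚ N) * toℚ c
  toℚ-divide N X σ s c N≢0 eq = *-cancelʳ-≡ _ _ (toℚ N) N≢0ℚ (begin
    toℚ X * toℚ N                               ≡⟨ toℚ-* X N ⟨
    toℚ (X ℤ.* N)                               ≡⟨ cong toℚ (trans (ℤ.*-comm X N) eq) ⟩
    toℚ (σ ℤ.* s ℤ.+ c)                         ≡⟨ trans (toℚ-+ (σ ℤ.* s) c) (cong (_+ toℚ c) (toℚ-* σ s)) ⟩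
    toℚ σ * toℚ s + toℚ c                       ≡⟨ ℚ.*-identityʳ _ ⟨
    (toℚ σ * toℚ s + toℚ c) * 1ℚ                ≡⟨ cong ((toℚ σ * toℚ s + toℚ c) *_) (p⊘q*q≡p 1ℚ (toℚ N) N≢0ℚ) ⟨
    (toℚ σ * toℚ s + toℚ c) * (w * toℚ N)       ≡⟨ regroup (toℚ σ) (toℚ s) (toℚ c) w (toℚ N) ⟩
    (toℚ σ * w * toℚ s + w * toℚ c) * toℚ N     ∎)
    where
    w = 1ℚ ⊘ toℚ N
    N≢0ℚ = toℚ-≢0 N≢0
    regroup : ∀ σ s c w n → (σ * s + c) * (w * n) ≡ (σ * w * s + w * c) * n
    regroup = solve 5 (λ σ s c w n → (σ :* s :+ c) :* (w :* n) := (σ :* w :* s :+ w :* c) :* n) refl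

open RationalEmbedding

module LagrangeInterpolation where

  open import Data.Rational using (_+_; _*_)
  open import Data.Integer.Tactic.RingSolver using (solve-∀)
  open import Data.Rational.Solver using (module +-*-Solver)
  open +-*-Solver using (solve; _:+_; _:*_; _:=_)
  open ≡-Reasoning

  lagrangeWeight : ℕ → ℕ → ℕ → ℚ
  lagrangeWeight n m l = toℚ (sgn l ℤ.* + (n C l)) * (toℚ (+ n ℤ.- + l) ⊘ toℚ (+ l ℤ.- + m))

  lagrangeSum : ℕ → ℕ → (ℤ → ℤ) → ℚ
  lagrangeSum n m P = toℚ (sgn n ℤ.* + (m C n)) * sumTo n (λ l → lagrangeWeight n m l * toℚ (P (+ l)))

  lagrange-node : ∀ {l n} k (P : ℤ → ℤ) → l ℕ.< n → let m = n ℕ.+ k in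
    toℚ (sgn n ℤ.* + (m C n)) * (lagrangeWeight n m l * toℚ (P (+ l))) * toℚ (+ (k !))
      ≡ toℚ (sgn (ℕ.suc m) ℤ.* (sgn l ℤ.* + (m C l) ℤ.* (rising (+ l ℤ.- + m) k ℤ.* P (+ l))))
  lagrange-node {l} {n} k P l<n = *-cancelʳ-≡ _ _ E E≢0 (begin
    A * (B * (N ⊘ E) * p) * K * E      ≡⟨ regroup A B (N ⊘ E) p K E ⟩
    A * B * ((N ⊘ E) * E) * p * K      ≡⟨ cong (λ z → A * B * z * p * K) (p⊘q*q≡p N E E≢0) ⟩
    A * B * N * p * K                  ≡⟨ toℚ-*₅ (sgn n ℤ.* + (m C n)) (sgn l ℤ.* + (n C l)) (+ n ℤ.- + l) (P (+ l)) (+ (k !)) ⟨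
    toℚ (sgn n ℤ.* + (m C n) ℤ.* (sgn l ℤ.* + (n C l)) ℤ.* (+ n ℤ.- + l) ℤ.* P (+ l) ℤ.* + (k !))
                                       ≡⟨ cong toℚ weight ⟩
    toℚ (σ ℤ.* w ℤ.* (+ l ℤ.- + m))    ≡⟨ toℚ-* (σ ℤ.* w) (+ l ℤ.- + m) ⟩
    toℚ (σ ℤ.* w) * E                  ∎)
    where
    m = n ℕ.+ k
    σ = sgn (ℕ.suc m)
    r = rising (+ l ℤ.- + m) k
    w = sgn l ℤ.* + (m C l) ℤ.* (r ℤ.* P (+ l))
    A = toℚ (sgn n ℤ.* + (m C n))
    B = toℚ (sgn l ℤ.* + (n C l))
    N = toℚ (+ n ℤ.- + l)
    E = toℚ (+ l ℤ.- + m)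
    K = toℚ (+ (k !))
    p = toℚ (P (+ l))
    E≢0 = toℚ-≢0 (λ l-m≡0 → ℕ.<⇒≢ (ℕ.<-≤-trans l<n (ℕ.m≤m+n n k))
                               (ℤ.+-injective (ℤ.i-j≡0⇒i≡j (+ l) (+ m) l-m≡0)))
    regroup : ∀ a b v p d e → a * (b * v * p) * d * e ≡ a * b * (v * e) * p * d
    regroup = solve 6 (λ a b v p d e → a :* (b :* v :* p) :* d :* e := a :* b :* (v :* e) :* p :* d) refl
    toℚ-*₅ : ∀ a b c d e → toℚ (a ℤ.* b ℤ.* c ℤ.* d ℤ.* e) ≡ toℚ a * toℚ b * toℚ c * toℚ d * toℚ e
    toℚ-*₅ a b c d e rewrite toℚ-* (a ℤ.* b ℤ.* c ℤ.* d) e | toℚ-* (a ℤ.* b ℤ.* c) d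
                           | toℚ-* (a ℤ.* b) c | toℚ-* a b = refl
    pull : ∀ a c s d x p κ → a ℤ.* c ℤ.* (s ℤ.* d) ℤ.* x ℤ.* p ℤ.* κ ≡ s ℤ.* p ℤ.* (a ℤ.* c ℤ.* d ℤ.* x ℤ.* κ)
    pull = solve-∀
    push : ∀ s p σ c r e → s ℤ.* p ℤ.* (σ ℤ.* c ℤ.* r ℤ.* e) ≡ σ ℤ.* (s ℤ.* c ℤ.* (r ℤ.* p)) ℤ.* e
    push = solve-∀
    weight : sgn n ℤ.* + (m C n) ℤ.* (sgn l ℤ.* + (n C l)) ℤ.* (+ n ℤ.- + l) ℤ.* P (+ l) ℤ.* + (k !)
             ≡ σ ℤ.* w ℤ.* (+ l ℤ.- + m)
    weight = begin
      sgn n ℤ.* + (m C n) ℤ.* (sgn l ℤ.* + (n C l)) ℤ.* (+ n ℤ.- + l) ℤ.* P (+ l) ℤ.* + (k !)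
        ≡⟨ pull (sgn n) (+ (m C n)) (sgn l) (+ (n C l)) (+ n ℤ.- + l) (P (+ l)) (+ (k !)) ⟩
      sgn l ℤ.* P (+ l) ℤ.* (sgn n ℤ.* + (m C n) ℤ.* + (n C l) ℤ.* (+ n ℤ.- + l) ℤ.* + (k !))
        ≡⟨ cong (sgn l ℤ.* P (+ l) ℤ.*_) (node-weight k l<n) ⟩
      sgn l ℤ.* P (+ l) ℤ.* (σ ℤ.* + (m C l) ℤ.* r ℤ.* (+ l ℤ.- + m))
        ≡⟨ push (sgn l) (P (+ l)) σ (+ (m C l)) r (+ l ℤ.- + m) ⟩
      σ ℤ.* w ℤ.* (+ l ℤ.- + m)
        ∎

  ConstantΔ^-lagrange : ∀ {n m} s P → n ℕ.≤ m → ConstantΔ^ n (s ℤ.* + (n !)) P →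
    toℚ (P (+ m)) ≡ lagrangeSum n m P + toℚ s * (toℚ (+ (m !)) ⊘ toℚ (+ ((m ∸ n) !)))
  ConstantΔ^-lagrange {n} s P n≤m h with ℕ.m≤n⇒∃[o]m+o≡n n≤m
  ... | k , refl = trans interpolation
    (cong (λ j → lagrangeSum n m P + toℚ s * (toℚ M! ⊘ toℚ (+ (j !)))) (sym (ℕ.m+n∸m≡n n k)))
    where
    m = n ℕ.+ k
    M! = + (m !)
    K = toℚ (+ (k !))
    A = toℚ (sgn n ℤ.* + (m C n))
    σ = sgn (ℕ.suc m)
    t : ℕ → ℚ
    t l = lagrangeWeight n m l * toℚ (P (+ l))
    w : ℕ → ℤ
    w l = sgn l ℤ.* + (m C l) ℤ.* (rising (+ l ℤ.- + m) k ℤ.* P (+ l))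
    K≢0 = toℚ-≢0 (λ k!≡0 → ℕ.<⇒≢ (ℕ.1≤n! k) (sym (ℤ.+-injective k!≡0)))
    distrib : ∀ a x s y d → (a * x + s * y) * d ≡ a * x * d + s * (y * d)
    distrib = solve 5 (λ a x s y d → (a :* x :+ s :* y) :* d := a :* x :* d :+ s :* (y :* d)) refl
    interpolation : toℚ (P (+ m)) ≡ A * sumTo n t + toℚ s * (toℚ M! ⊘ K)
    interpolation = *-cancelʳ-≡ _ _ K K≢0 (sym (begin
      (A * sumTo n t + toℚ s * (toℚ M! ⊘ K)) * K        ≡⟨ distrib A (sumTo n t) (toℚ s) (toℚ M! ⊘ K) K ⟩
      A * sumTo n t * K + toℚ s * ((toℚ M! ⊘ K) * K)    ≡⟨ cong₂ _+_ (sumTo-* n A K t) (cong (toℚ s *_) (p⊘q*q≡p _ K K≢0)) ⟩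
      sumTo n (λ l → A * t l * K) + toℚ s * toℚ M!      ≡⟨ cong₂ _+_ (sumTo-cong< n (λ l → lagrange-node k P)) (sym (toℚ-* s M!)) ⟩
      sumTo n (λ l → toℚ (σ ℤ.* w l)) + toℚ (s ℤ.* M!)  ≡⟨ cong (_+ toℚ (s ℤ.* M!)) (toℚ-sumToℤ n (λ l → σ ℤ.* w l)) ⟨
      toℚ (sumToℤ n (λ l → σ ℤ.* w l)) + toℚ (s ℤ.* M!) ≡⟨ cong (λ z → toℚ z + toℚ (s ℤ.* M!)) (sumToℤ-*ˡ n σ w) ⟩
      toℚ (σ ℤ.* sumToℤ n w) + toℚ (s ℤ.* M!)           ≡⟨ toℚ-+ (σ ℤ.* sumToℤ n w) (s ℤ.* M!) ⟨
      toℚ (σ ℤ.* sumToℤ n w ℤ.+ s ℤ.* M!)               ≡⟨ cong toℚ (ConstantΔ^-interpolate n k {s} {P} h) ⟨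
      toℚ (+ (k !) ℤ.* P (+ m))                         ≡⟨ trans (toℚ-* (+ (k !)) (P (+ m))) (ℚ.*-comm K (toℚ (P (+ m)))) ⟩
      toℚ (P (+ m)) * K                                 ∎))

open LagrangeInterpolation

module BackwardExtrapolation where

  open import Data.Integer.Tactic.RingSolver using (solve-∀)
  open ≡-Reasoning

  backwardSum : ℕ → ℕ → ℤ → (ℤ → ℤ) → ℚ
  backwardSum n q m P = toℚ (sgn (n ℕ.+ 1)) ℚ.* (ℚ.1ℚ ⊘ toℚ ((+ n) ℤ.^ q))
    ℚ.* sumTo n (λ l → toℚ (sgn l ℤ.* + (n C l) ℤ.* ((+ l) ℤ.^ q) ℤ.* P (m ℤ.- + n ℤ.+ + l)))

  x^q*P-extrapolate : ∀ n q (P : ℤ → ℤ) m c → 1 ≤ n →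
    ConstantΔ^ n c (λ x → x ℤ.^ q ℤ.* P (m ℤ.- + n ℤ.+ x)) →
    toℚ (P m) ≡ backwardSum n q m P ℚ.+ (ℚ.1ℚ ⊘ toℚ ((+ n) ℤ.^ q)) ℚ.* toℚ c
  x^q*P-extrapolate n q P m c 1≤n h =
    trans (toℚ-divide N (P m) σ (sumToℤ n g) c N≢0 weighted)
          (cong (λ z → toℚ σ ℚ.* (ℚ.1ℚ ⊘ toℚ N) ℚ.* z ℚ.+ (ℚ.1ℚ ⊘ toℚ N) ℚ.* toℚ c) (toℚ-sumToℤ n g))
    where
    N = (+ n) ℤ.^ q
    σ = sgn (n ℕ.+ 1)
    f : ℤ → ℤ
    f x = x ℤ.^ q ℤ.* P (m ℤ.- + n ℤ.+ x)
    g : ℕ → ℤ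
    g l = sgn l ℤ.* + (n C l) ℤ.* ((+ l) ℤ.^ q) ℤ.* P (m ℤ.- + n ℤ.+ + l)
    N≢0 : ¬ (N ≡ + 0)
    N≢0 N≡0 = ℕ.<⇒≢ 1≤n (sym (ℤ.+-injective (ℤ.i^n≡0⇒i≡0 (+ n) q N≡0)))
    weighted : N ℤ.* P m ≡ σ ℤ.* sumToℤ n g ℤ.+ c
    weighted = begin
      N ℤ.* P m                                           ≡⟨ cong (λ x → N ℤ.* P x) (m-n+n≡m m (+ n)) ⟨
      f (+ n)                                              ≡⟨ ConstantΔ^-extrapolate h ⟩
      sgn (ℕ.suc n) ℤ.* sumToℤ n (λ l → sgn l ℤ.* + (n C l) ℤ.* f (+ l)) ℤ.+ c
        ≡⟨ cong₂ (λ s t → sgn s ℤ.* t ℤ.+ c) (ℕ.+-comm 1 n)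
                 (sumToℤ-cong< n (λ l _ → sym (ℤ.*-assoc (sgn l ℤ.* + (n C l)) _ _))) ⟩
      σ ℤ.* sumToℤ n g ℤ.+ c                              ∎
      where m-n+n≡m : ∀ m n → m ℤ.- n ℤ.+ n ≡ m
            m-n+n≡m = solve-∀

open BackwardExtrapolation

proposition4p3 :
    ((n m : ℕ) → 1 ≤ n → 1 ≤ m → n ≤ m →
      toℚ (F (+ m) (ℕ.suc n))
        ≡ toℚ (sgn n ℤ.* + (m C n))
            ℚ.* sumTo n (λ l → toℚ (sgn l ℤ.* + (n C l))
                                 ℚ.* (toℚ (+ n ℤ.- + l) ⊘ toℚ (+ l ℤ.- + m))
                                 ℚ.* toℚ (F (+ l) (ℕ.suc n)))
          ℚ.+ (toℚ (+ (m !)) ⊘ toℚ (+ ((m ∸ n) !))))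
    × ((n m : ℕ) → 1 ≤ n → 1 ≤ m → n ≤ m →
      toℚ (F (ℤ.- (+ m)) (ℕ.suc n))
        ≡ toℚ (sgn n ℤ.* + (m C n))
            ℚ.* sumTo n (λ l → toℚ (sgn l ℤ.* + (n C l))
                                 ℚ.* (toℚ (+ n ℤ.- + l) ⊘ toℚ (+ l ℤ.- + m))
                                 ℚ.* toℚ (F (ℤ.- (+ l)) (ℕ.suc n)))
          ℚ.+ toℚ (sgn n) ℚ.* (toℚ (+ (m !)) ⊘ toℚ (+ ((m ∸ n) !))))
    × ((n p q : ℕ) (m : ℤ) → 1 ≤ n → 1 ≤ p → p ℕ.+ 1 ≤ n → q < p →
      toℚ (F m (n ∸ p ℕ.+ 1))
        ≡ toℚ (sgn (n ℕ.+ 1)) ℚ.* (ℚ.1ℚ ⊘ toℚ ((+ n) ℤ.^ q))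
            ℚ.* sumTo n (λ l → toℚ (sgn l ℤ.* + (n C l) ℤ.* ((+ l) ℤ.^ q)
                                     ℤ.* F (m ℤ.- + n ℤ.+ + l) (n ∸ p ℕ.+ 1))))
    × ((n p : ℕ) (m : ℤ) → 1 ≤ n → 1 ≤ p → p ℕ.+ 1 ≤ n →
      toℚ (F m (n ∸ p ℕ.+ 1))
        ≡ toℚ (sgn (n ℕ.+ 1)) ℚ.* (ℚ.1ℚ ⊘ toℚ ((+ n) ℤ.^ p))
            ℚ.* sumTo n (λ l → toℚ (sgn l ℤ.* + (n C l) ℤ.* ((+ l) ℤ.^ p)
                                     ℤ.* F (m ℤ.- + n ℤ.+ + l) (n ∸ p ℕ.+ 1)))
          ℚ.+ (ℚ.1ℚ ⊘ toℚ ((+ n) ℤ.^ p)) ℚ.* toℚ (+ (n !)))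
proposition4p3 =
    (λ n m _ _ n≤m →
      trans (ConstantΔ^-lagrange (+ 1) (λ x → F x (suc n)) n≤m
              (ConstantΔ^-cong (λ x → ℤ.*-identityˡ (F x (suc n))) (scaled-F (+ 1) n)))
            (x+1*y≡x+y (lagrangeSum n m (λ x → F x (suc n))) (toℚ (+ (m !)) ⊘ toℚ (+ ((m ∸ n) !)))))
  , (λ n m _ _ n≤m →
      ConstantΔ^-lagrange (sgn n) (λ x → F (ℤ.- x) (suc n)) n≤m
        (ConstantΔ^-cong (λ x → sym (F-neg x n)) (scaled-F (sgn n) n)))
  , (λ n p q m 1≤n _ p+1≤n q<p →
      trans (x^q*P-extrapolate n q (λ x → F x (n ∸ p ℕ.+ 1)) m (+ 0) 1≤n
              (ConstantΔ^-< (q+[n∸p]<n q<p (ℕ.m+n≤o⇒m≤o p p+1≤n)) (ConstantΔ^-x^q*F q (n ∸ p) (m ℤ.- + n) refl)))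
            (x+w*0≡x (backwardSum n q m (λ x → F x (n ∸ p ℕ.+ 1))) (ℚ.1ℚ ⊘ toℚ ((+ n) ℤ.^ q))))
  , (λ n p m 1≤n _ p+1≤n →
      x^q*P-extrapolate n p (λ x → F x (n ∸ p ℕ.+ 1)) m (+ (n !)) 1≤n
        (ConstantΔ^-x^q*F p (n ∸ p) (m ℤ.- + n) (ℕ.m+[n∸m]≡n (ℕ.m+n≤o⇒m≤o p p+1≤n))))
  where
  scaled-F : ∀ s n → ConstantΔ^ n (s ℤ.* + (n !)) (λ x → s ℤ.* F x (suc n))
  scaled-F s n = ConstantΔ^-*ˡ s (proj₁ (ConstantΔ^-F n))
  x+1*y≡x+y : ∀ x y → x ℚ.+ toℚ (+ 1) ℚ.* y ≡ x ℚ.+ y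
  x+1*y≡x+y x y = cong (x ℚ.+_) (ℚ.*-identityˡ y)
  x+w*0≡x : ∀ x w → x ℚ.+ w ℚ.* toℚ (+ 0) ≡ x
  x+w*0≡x x w = trans (cong (x ℚ.+_) (ℚ.*-zeroʳ w)) (ℚ.+-identityʳ x)
  q+[n∸p]<n : ∀ {n p q} → q < p → p ≤ n → q ℕ.+ (n ∸ p) < n
  q+[n∸p]<n {n} {p} q<p p≤n = ℕ.<-≤-trans (ℕ.+-monoˡ-< (n ∸ p) q<p) (ℕ.≤-reflexive (ℕ.m+[n∸m]≡n p≤n))
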